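{- Let $n$ be a positive integer and $0\le s\le\lfloor n/2\rfloor$. Then: (i) $K_{n+3}(s+1)=K_{n+2}(s+1)+K_{n+1}(s)+K_n(s)$; (ii) $K_{n+3}(s)=K_{n+2}(s)+K_{n+1}(s)+K_n(s)-B(n+1-s,s)-B(n-s,s)$.
   Context: Binomial coefficients satisfy $\binom{m}{k}=0$ for $k>m$. For integers $m>i\ge0$ let $B(m,i)=\sum_{j=0}^{i}\frac{m+i}{m-j}\binom{i}{j}\binom{m-j}{i}$, and for $m\ge1$ let $B(m,m)=2$. For a positive integer $n$ and $0\le s\le\lfloor n/2\rfloor$, the incomplete Tribonacci-Lucas number is $$K_n(s)=\sum_{i=0}^{s}B(n-i,i)=\sum_{i=0}^{s}\ \sum_{\substack{0\le j\le i\\ i+j<n}}\frac{n}{n-i-j}\binom{i}{j}\binom{n-i-j}{i}.$$ -}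

module Defs where

open import Data.Nat using (ℕ; zero; suc; _∸_; _<?_)
import Data.Nat as ℕ
open import Data.Nat.Combinatorics using (_C_)
open import Data.Integer using (+_)
open import Data.Rational using (ℚ; _/_; _+_; 0ℚ)
open import Relation.Nullary using (yes; no)

-- a / d as a rational, for d ≠ 0 (the d = 0 branch is never used below)
frac : ℕ → ℕ → ℚ
frac a zero    = 0ℚ
frac a (suc d) = (+ a) / suc d

sumTo : ℕ → (ℕ → ℚ) → ℚ
sumTo zero    f = f 0
sumTo (suc k) f = sumTo k f + f (suc k)

-- B(m,i) = Σ_{j=0}^{i} (m+i)/(m-j) · C(i,j) · C(m-j,i)   for m > i ≥ 0,
-- B(m,m) = 2 (m ≥ 1). Values for i > m (and B(0,0)) are never used.
B : ℕ → ℕ → ℚ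
B m i with i <? m
... | yes _ = sumTo i (λ j → frac ((m ℕ.+ i) ℕ.* (i C j) ℕ.* ((m ∸ j) C i)) (m ∸ j))
... | no  _ = (+ 2) / 1

K : ℕ → ℕ → ℚ
K n s = sumTo s (λ i → B (n ∸ i) i)

module Submission where

-- The rational summands of B(m,i) are natural numbers with a combinatorial
-- meaning.  With N = m + i, the j-th summand N/(N-i-j)·C(i,j)·C(N-i-j,i) counts
-- the tilings of a cycle of N cells (one of them marked) by squares, i-j
-- dominoes and j trominoes; B(m,m) = 2 counts the two tilings of a 2m-cycle by
-- dominoes.  So B(N-i,i) is the number cyclicB N i of cyclic tilings with i
-- long tiles and K_N(s) the number cyclicK N s with at most s long tiles.
-- Cyclic tilings are a fixed combination of linear ones, which satisfy the
-- Tribonacci recurrence in the length (remove the last tile).  Summing it over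
-- a layer gives cyclicB (N+3) (i+1) = cyclicB (N+2) (i+1) + cyclicB (N+1) i +
-- cyclicB N i, and summing over i gives both parts of the theorem in ℕ.

module BinomialIdentities where

  open import Data.Nat using (zero; suc; _+_; _*_)
  open import Data.Nat.Properties using (*-zeroʳ; *-identityˡ; *-identityʳ; +-identityʳ; +-comm; *-distribˡ-+)
  open import Data.Nat.Combinatorics using (_C_; nCk+nC[k+1]≡[n+1]C[k+1]; nC1≡n)
  open import Data.Nat.Tactic.RingSolver using (solve-∀)
  open import Relation.Binary.PropositionalEquality using (_≡_; refl; sym; trans; cong; module ≡-Reasoning)
  open ≡-Reasoning

  pascal : ∀ n k → n C k + n C suc k ≡ suc n C suc k
  pascal = nCk+nC[k+1]≡[n+1]C[k+1]

  absorption : ∀ n k → suc k * (suc n C suc k) ≡ suc n * (n C k)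
  absorption zero    zero    = refl
  absorption zero    (suc k) = *-zeroʳ (suc (suc k))
  absorption (suc n) zero    = trans (*-identityˡ _) (trans (nC1≡n (suc (suc n))) (sym (*-identityʳ _)))
  absorption (suc n) (suc k) = begin
    suc (suc k) * (suc (suc n) C suc (suc k))             ≡⟨ cong (suc (suc k) *_) (sym (pascal (suc n) (suc k))) ⟩
    suc (suc k) * (suc n C suc k + suc n C suc (suc k))   ≡⟨ step (absorption n (suc k)) (absorption n k) (pascal n k) ⟩
    suc (suc n) * (suc n C suc k)                         ∎
    where
    step : ∀ {X Y Z W} → suc (suc k) * Y ≡ suc n * Z → suc k * X ≡ suc n * W → W + Z ≡ X →
           suc (suc k) * (X + Y) ≡ suc (suc n) * X
    step {X} {Y} {Z} {W} hY hX hW = begin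
      suc (suc k) * (X + Y)                   ≡⟨ expand (suc k) X Y ⟩
      X + suc k * X + suc (suc k) * Y         ≡⟨ cong (λ a → X + a + suc (suc k) * Y) hX ⟩
      X + suc n * W + suc (suc k) * Y         ≡⟨ cong (X + suc n * W +_) hY ⟩
      X + suc n * W + suc n * Z               ≡⟨ collect X (suc n) W Z ⟩
      X + suc n * (W + Z)                     ≡⟨ cong (λ a → X + suc n * a) hW ⟩
      suc (suc n) * X                         ∎
      where
      expand : ∀ a X Y → (1 + a) * (X + Y) ≡ X + a * X + (1 + a) * Y
      expand = solve-∀
      collect : ∀ X a W Z → X + a * W + a * Z ≡ X + a * (W + Z)
      collect = solve-∀

  -- The companion identity (n+1)·C(n,k) + k·C(n+1,k) = (n+1)·C(n+1,k),
  -- i.e. (n+1-k)·C(n+1,k) = (n+1)·C(n,k) without subtraction.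
  absorption-complement : ∀ n k → suc n * (n C k) + k * (suc n C k) ≡ suc n * (suc n C k)
  absorption-complement n zero    = +-identityʳ _
  absorption-complement n (suc k) = begin
    suc n * (n C suc k) + suc k * (suc n C suc k)   ≡⟨ cong (suc n * (n C suc k) +_) (absorption n k) ⟩
    suc n * (n C suc k) + suc n * (n C k)           ≡⟨ sym (*-distribˡ-+ (suc n) (n C suc k) (n C k)) ⟩
    suc n * (n C suc k + n C k)                     ≡⟨ cong (suc n *_) (trans (+-comm (n C suc k) (n C k)) (pascal n k)) ⟩
    suc n * (suc n C suc k)                         ∎

module Tilings where

  open BinomialIdentities
  open import Data.Nat using (ℕ; zero; suc; _+_; _*_)
  open import Data.Nat.Properties using (*-zeroʳ; *-identityˡ; +-identityʳ; +-suc; suc-injective)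
  open import Data.Nat.Combinatorics using (_C_; nCn≡1)
  open import Data.Nat.Tactic.RingSolver using (solve-∀)
  open import Relation.Binary.PropositionalEquality using (_≡_; refl; sym; trans; cong; cong₂; module ≡-Reasoning)
  open ≡-Reasoning

  mutual
    -- tilings n v w: the number of tilings of a strip of length n by
    -- squares, v dominoes and w trominoes, classified by the last tile.
    tilings : ℕ → ℕ → ℕ → ℕ
    tilings zero    zero    zero    = 1
    tilings zero    zero    (suc w) = 0
    tilings zero    (suc v) w       = 0
    tilings (suc n) v w = tilings n v w + endDomino n v w + endTromino n v w

    endDomino : ℕ → ℕ → ℕ → ℕ
    endDomino n       zero    w = 0
    endDomino zero    (suc v) w = 0
    endDomino (suc n) (suc v) w = tilings n v w

    endTromino : ℕ → ℕ → ℕ → ℕ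
    endTromino n             v zero    = 0
    endTromino zero          v (suc w) = 0
    endTromino (suc zero)    v (suc w) = 0
    endTromino (suc (suc n)) v (suc w) = tilings n v w

  endDomino-at : ∀ {n m v w} → n ≡ suc m → endDomino n (suc v) w ≡ tilings m v w
  endDomino-at refl = refl

  endTromino-at : ∀ {n m v w} → n ≡ suc (suc m) → endTromino n v (suc w) ≡ tilings m v w
  endTromino-at refl = refl

  tilings-squares : ∀ n → tilings n 0 0 ≡ 1
  tilings-squares zero    = refl
  tilings-squares (suc n) = trans (+-identityʳ _) (trans (+-identityʳ _) (tilings-squares n))

  -- No tiling exists when the dominoes and trominoes alone are longer than the
  -- strip, i.e. n + (d+1) = 2v + 3w.
  mutual
    tilings-vanish : ∀ n v w d → n + suc d ≡ v + v + w + w + w → tilings n v w ≡ 0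
    tilings-vanish zero    zero    zero    d ()
    tilings-vanish zero    zero    (suc w) d eq = refl
    tilings-vanish zero    (suc v) w       d eq = refl
    tilings-vanish (suc n) v w d eq =
      cong₂ _+_ (cong₂ _+_ (tilings-vanish n v w (suc d) (trans (+-suc n (suc d)) eq))
                           (endDomino-vanish n v w d eq))
                (endTromino-vanish n v w d eq)

    endDomino-vanish : ∀ n v w d → suc n + suc d ≡ v + v + w + w + w → endDomino n v w ≡ 0
    endDomino-vanish n       zero    w d eq = refl
    endDomino-vanish zero    (suc v) w d eq = refl
    endDomino-vanish (suc n) (suc v) w d eq =
      tilings-vanish n v w d (suc-injective (suc-injective (trans eq (lengths v w))))
      where
      lengths : ∀ v w → (1 + v) + (1 + v) + w + w + w ≡ 2 + (v + v + w + w + w)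
      lengths = solve-∀

    endTromino-vanish : ∀ n v w d → suc n + suc d ≡ v + v + w + w + w → endTromino n v w ≡ 0
    endTromino-vanish n             v zero    d eq = refl
    endTromino-vanish zero          v (suc w) d eq = refl
    endTromino-vanish (suc zero)    v (suc w) d eq = refl
    endTromino-vanish (suc (suc n)) v (suc w) d eq =
      tilings-vanish n v w d (suc-injective (suc-injective (suc-injective (trans eq (lengths v w)))))
      where
      lengths : ∀ v w → v + v + (1 + w) + (1 + w) + (1 + w) ≡ 3 + (v + v + w + w + w)
      lengths = solve-∀

  -- Closed form: a tiling with v dominoes, w trominoes and k tiles in total
  -- (length k + v + 2w) is a choice of the v+w long tiles among the k and of
  -- which w of them are trominoes.
  mutual
    tilings-closed : ∀ k v w → tilings (k + (v + w + w)) v w ≡ ((v + w) C w) * (k C (v + w))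
    tilings-closed zero zero zero = refl
    tilings-closed zero (suc v) w =
      trans (tilings-vanish (suc v + w + w) (suc v) w (v + w) (lengths v w)) (sym (*-zeroʳ ((suc v + w) C w)))
      where
      lengths : ∀ v w → (1 + v + w + w) + (1 + (v + w)) ≡ (1 + v) + (1 + v) + w + w + w
      lengths = solve-∀
    tilings-closed zero zero (suc w) =
      trans (tilings-vanish (suc w + suc w) 0 (suc w) w (lengths w)) (sym (*-zeroʳ (suc w C suc w)))
      where
      lengths : ∀ w → ((1 + w) + (1 + w)) + (1 + w) ≡ (1 + w) + (1 + w) + (1 + w)
      lengths = solve-∀
    tilings-closed (suc k) zero zero = tilings-squares (suc (k + 0))
    tilings-closed (suc k) (suc v) zero = begin
      tilings (k + (suc v + 0 + 0)) (suc v) 0 + endDomino (k + (suc v + 0 + 0)) (suc v) 0 + 0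
        ≡⟨ cong₂ (λ a b → a + b + 0) (tilings-closed k (suc v) 0) (endDomino-closed k v 0) ⟩
      1 * (k C suc I) + 1 * (k C I) + 0   ≡⟨ rearrange (k C suc I) (k C I) ⟩
      k C I + k C suc I                   ≡⟨ pascal k I ⟩
      suc k C suc I                       ≡⟨ sym (*-identityˡ (suc k C suc I)) ⟩
      1 * (suc k C suc I)                 ∎
      where
      I = v + 0
      rearrange : ∀ a b → 1 * a + 1 * b + 0 ≡ b + a
      rearrange = solve-∀
    tilings-closed (suc k) zero (suc w) = begin
      tilings (k + (suc w + suc w)) 0 (suc w) + 0 + endTromino (k + (suc w + suc w)) 0 (suc w)
        ≡⟨ cong₂ (λ a b → a + 0 + b) (tilings-closed k 0 (suc w)) (endTromino-closed k 0 w) ⟩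
      (suc w C suc w) * (k C suc w) + 0 + (w C w) * (k C w)
        ≡⟨ cong₂ (λ a b → a * (k C suc w) + 0 + b * (k C w)) (nCn≡1 (suc w)) (nCn≡1 w) ⟩
      1 * (k C suc w) + 0 + 1 * (k C w)   ≡⟨ rearrange (k C suc w) (k C w) ⟩
      k C w + k C suc w                   ≡⟨ pascal k w ⟩
      suc k C suc w                       ≡⟨ sym (*-identityˡ (suc k C suc w)) ⟩
      1 * (suc k C suc w)                 ≡⟨ cong (_* (suc k C suc w)) (sym (nCn≡1 (suc w))) ⟩
      (suc w C suc w) * (suc k C suc w)   ∎
      where
      rearrange : ∀ a b → 1 * a + 0 + 1 * b ≡ b + a
      rearrange = solve-∀
    tilings-closed (suc k) (suc v) (suc w) = begin
      tilings (k + X) (suc v) (suc w) + endDomino (k + X) (suc v) (suc w) + endTromino (k + X) (suc v) (suc w)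
        ≡⟨ cong₂ _+_ (cong₂ _+_ (tilings-closed k (suc v) (suc w)) (endDomino-closed k v (suc w)))
                     (trans (endTromino-closed k (suc v) w) (cong (λ j → (j C w) * (k C j)) (sym (+-suc v w)))) ⟩
      c * (k C suc I) + (I C suc w) * b + (I C w) * b    ≡⟨ rearrange c (k C suc I) (I C suc w) (I C w) b ⟩
      c * (k C suc I) + (I C w + I C suc w) * b          ≡⟨ cong (λ y → c * (k C suc I) + y * b) (pascal I w) ⟩
      c * (k C suc I) + c * b                            ≡⟨ factor c (k C suc I) b ⟩
      c * (b + k C suc I)                                ≡⟨ cong (c *_) (pascal k I) ⟩
      c * (suc k C suc I)                                ∎
      where
      X = suc v + suc w + suc w
      I = v + suc w
      c = suc I C suc w
      b = k C I
      rearrange : ∀ c a P P' b → c * a + P * b + P' * b ≡ c * a + (P' + P) * b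
      rearrange = solve-∀
      factor : ∀ c a b → c * a + c * b ≡ c * (b + a)
      factor = solve-∀

    endDomino-closed : ∀ k v w → endDomino (k + (suc v + w + w)) (suc v) w ≡ ((v + w) C w) * (k C (v + w))
    endDomino-closed k v w = trans (endDomino-at (+-suc k (v + w + w))) (tilings-closed k v w)

    endTromino-closed : ∀ k v w → endTromino (k + (v + suc w + suc w)) v (suc w) ≡ ((v + w) C w) * (k C (v + w))
    endTromino-closed k v w = trans (endTromino-at (lengths k v w)) (tilings-closed k v w)
      where
      lengths : ∀ k v w → k + (v + suc w + suc w) ≡ 2 + (k + (v + w + w))
      lengths = solve-∀

module CyclicTilings where

  open BinomialIdentities
  open Tilings
  open import Data.Nat using (ℕ; zero; suc; _+_; _*_)
  open import Data.Nat.Properties using (*-zeroʳ; +-suc; *-cancelˡ-≡; +-cancelʳ-≡)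
  open import Data.Nat.Combinatorics using (_C_)
  open import Data.Nat.Tactic.RingSolver using (solve-∀)
  open import Relation.Binary.PropositionalEquality using (_≡_; refl; sym; trans; cong; cong₂; module ≡-Reasoning)
  open ≡-Reasoning

  -- cyclic n v w: tilings of a cycle of n cells with a marked cell.  The tile
  -- covering the marked cell is a square, a domino in one of 2 positions or a
  -- tromino in one of 3 positions; what remains is a strip of length n-1.
  cyclic : ℕ → ℕ → ℕ → ℕ
  cyclic zero    v w = 0
  cyclic (suc n) v w = tilings n v w + 2 * endDomino n v w + 3 * endTromino n v w

  withDomino : (ℕ → ℕ → ℕ) → ℕ → ℕ → ℕ
  withDomino f zero    w = 0
  withDomino f (suc v) w = f v w

  withTromino : (ℕ → ℕ → ℕ) → ℕ → ℕ → ℕ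
  withTromino f v zero    = 0
  withTromino f v (suc w) = f v w

  -- Both count tilings of length n-1 with one domino/tromino fewer.
  endTromino≡endDomino : ∀ n v w → endTromino (suc n) v (suc w) ≡ endDomino n (suc v) w
  endTromino≡endDomino zero    v w = refl
  endTromino≡endDomino (suc n) v w = refl

  -- The Tribonacci-type recurrence of cyclic tilings: it is inherited from the
  -- recurrence of linear tilings, of which cyclic is a fixed linear combination.
  cyclic-rec : ∀ n v w → cyclic (suc (suc (suc (suc n)))) v w
             ≡ cyclic (suc (suc (suc n))) v w + withDomino (cyclic (suc (suc n))) v w + withTromino (cyclic (suc n)) v w
  cyclic-rec n zero zero = collect (tilings (suc (suc n)) 0 0)
    where
    collect : ∀ a → a + 0 + 0 + 2 * 0 + 3 * 0 ≡ a + 2 * 0 + 3 * 0 + 0 + 0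
    collect = solve-∀
  cyclic-rec n (suc v) zero = collect (tilings (suc (suc n)) (suc v) 0) (tilings (suc n) v 0) (endDomino (suc n) v 0)
    where
    collect : ∀ a b d → a + b + 0 + 2 * (b + d + 0) + 3 * 0 ≡ (a + 2 * b + 3 * 0) + (b + 2 * d + 3 * 0) + 0
    collect = solve-∀
  cyclic-rec n zero (suc w) = collect (tilings (suc (suc n)) 0 (suc w)) (tilings n 0 w) (endTromino n 0 w)
    where
    collect : ∀ a c g → a + 0 + c + 2 * 0 + 3 * (c + 0 + g) ≡ (a + 2 * 0 + 3 * c) + 0 + (c + 2 * 0 + 3 * g)
    collect = solve-∀
  cyclic-rec n (suc v) (suc w) =
    collect (tilings (suc (suc n)) (suc v) (suc w)) (tilings (suc n) v (suc w)) (tilings n (suc v) w)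
            (endDomino (suc n) v (suc w)) (endTromino (suc n) v (suc w)) (endDomino n (suc v) w) (endTromino n (suc v) w)
            (endTromino≡endDomino n v w)
    where
    collect : ∀ a b c d e f g → e ≡ f →
              a + b + c + 2 * (b + d + e) + 3 * (c + f + g) ≡ (a + 2 * b + 3 * c) + (b + 2 * d + 3 * e) + (c + 2 * f + 3 * g)
    collect a b c d e .e g refl = linear a b c d e g
      where
      linear : ∀ a b c d e g → a + b + c + 2 * (b + d + e) + 3 * (c + e + g) ≡ (a + 2 * b + 3 * c) + (b + 2 * d + 3 * e) + (c + 2 * e + 3 * g)
      linear = solve-∀

  cyclic-vanish : ∀ n v w d → n + suc d ≡ v + v + w + w + w → cyclic n v w ≡ 0
  cyclic-vanish zero    v w d eq = refl
  cyclic-vanish (suc n) v w d eq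
    rewrite tilings-vanish n v w (suc d) (trans (+-suc n (suc d)) eq)
          | endDomino-vanish n v w d eq
          | endTromino-vanish n v w d eq = refl

  -- The algebra behind the closed form of cyclic tilings.  For K tiles of which
  -- j = i+1 are long and w of those trominoes, set a = C(K-1,j), a' = C(K,j),
  -- b = C(K-1,i), c = C(j,w), P = C(i,w), P' = C(i,w-1).  The hypotheses are the
  -- absorption identities relating them; the conclusion reads
  -- (K+j+w)·c·a' = K·(c·a + 2·P·b + 3·P'·b).  It is proved after multiplying by
  -- j and adding E = 2·(j·a')·(w·c) to both sides, which avoids subtraction.
  cyclic-weights : ∀ K i w c a a' b P P' →
    K * a + suc i * a' ≡ K * a' → suc i * a' ≡ K * b →
    suc i * P + w * c ≡ suc i * c → w * c ≡ suc i * P' →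
    (K + (suc i + w)) * (c * a') ≡ K * (c * a + 2 * (P * b) + 3 * (P' * b))
  cyclic-weights K i w c a a' b P P' hK hKb hw hw' =
    *-cancelˡ-≡ _ _ j (+-cancelʳ-≡ E _ _ (trans left (sym right)))
    where
    j = suc i
    E = 2 * ((j * a') * (w * c))
    common = c * j * (K * a) + 2 * ((j * a') * (j * c)) + 3 * ((w * c) * (j * a'))
    left : j * ((K + (j + w)) * (c * a')) + E ≡ common
    left = begin
      j * ((K + (j + w)) * (c * a')) + E
        ≡⟨ expand j K w c a' ⟩
      c * j * (K * a') + c * j * (j * a') + 3 * ((w * c) * (j * a'))
        ≡⟨ cong (λ z → c * j * z + c * j * (j * a') + 3 * ((w * c) * (j * a'))) (sym hK) ⟩
      c * j * (K * a + j * a') + c * j * (j * a') + 3 * ((w * c) * (j * a'))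
        ≡⟨ regroup c j K a a' w ⟩
      common ∎
      where
      expand : ∀ j K w c a' → j * ((K + (j + w)) * (c * a')) + 2 * ((j * a') * (w * c))
             ≡ c * j * (K * a') + c * j * (j * a') + 3 * ((w * c) * (j * a'))
      expand = solve-∀
      regroup : ∀ c j K a a' w → c * j * (K * a + j * a') + c * j * (j * a') + 3 * ((w * c) * (j * a'))
              ≡ c * j * (K * a) + 2 * ((j * a') * (j * c)) + 3 * ((w * c) * (j * a'))
      regroup = solve-∀
    right : j * (K * (c * a + 2 * (P * b) + 3 * (P' * b))) + E ≡ common
    right = begin
      j * (K * (c * a + 2 * (P * b) + 3 * (P' * b))) + E
        ≡⟨ expand j K c a P b P' a' w ⟩
      c * j * (K * a) + 2 * ((j * P) * (K * b)) + 3 * ((j * P') * (K * b)) + E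
        ≡⟨ cong₂ (λ x y → c * j * (K * a) + 2 * ((j * P) * x) + 3 * (y * x) + E) (sym hKb) (sym hw') ⟩
      c * j * (K * a) + 2 * ((j * P) * (j * a')) + 3 * ((w * c) * (j * a')) + E
        ≡⟨ regroup c j K a P a' w ⟩
      c * j * (K * a) + 2 * ((j * a') * (j * P + w * c)) + 3 * ((w * c) * (j * a'))
        ≡⟨ cong (λ z → c * j * (K * a) + 2 * ((j * a') * z) + 3 * ((w * c) * (j * a'))) hw ⟩
      common ∎
      where
      expand : ∀ j K c a P b P' a' w → j * (K * (c * a + 2 * (P * b) + 3 * (P' * b))) + 2 * ((j * a') * (w * c))
             ≡ c * j * (K * a) + 2 * ((j * P) * (K * b)) + 3 * ((j * P') * (K * b)) + 2 * ((j * a') * (w * c))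
      expand = solve-∀
      regroup : ∀ c j K a P a' w → c * j * (K * a) + 2 * ((j * P) * (j * a')) + 3 * ((w * c) * (j * a')) + 2 * ((j * a') * (w * c))
              ≡ c * j * (K * a) + 2 * ((j * a') * (j * P + w * c)) + 3 * ((w * c) * (j * a'))
      regroup = solve-∀

  cyclic-closed : ∀ k v w → (suc k + (v + w + w)) * (((v + w) C w) * (suc k C (v + w)))
                          ≡ suc k * cyclic (suc k + (v + w + w)) v w
  cyclic-closed k zero zero rewrite tilings-squares (k + 0) = arithmetic (suc k)
    where
    arithmetic : ∀ K → (K + 0) * (1 * 1) ≡ K * (1 + 2 * 0 + 3 * 0)
    arithmetic = solve-∀
  cyclic-closed k (suc v) zero =
    trans (cyclic-weights (suc k) I 0 (suc I C 0) (k C suc I) (suc k C suc I) (k C I) (I C 0) 0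
            (absorption-complement k (suc I)) (absorption k I) (absorption-complement I 0) (sym (*-zeroʳ (suc I))))
          (cong (suc k *_) (sym expansion))
    where
    I = v + 0
    expansion : tilings (k + (suc v + 0 + 0)) (suc v) 0 + 2 * endDomino (k + (suc v + 0 + 0)) (suc v) 0 + 3 * 0
              ≡ (suc I C 0) * (k C suc I) + 2 * ((I C 0) * (k C I)) + 3 * (0 * (k C I))
    expansion = cong₂ (λ x y → x + 2 * y + 3 * 0) (tilings-closed k (suc v) 0) (endDomino-closed k v 0)
  cyclic-closed k zero (suc w) =
    trans (cyclic-weights (suc k) w (suc w) (suc w C suc w) (k C suc w) (suc k C suc w) (k C w) 0 (w C w)
            (absorption-complement k (suc w)) (absorption k w) (cong (_+ suc w * (suc w C suc w)) (*-zeroʳ (suc w)))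
            (absorption w w))
          (cong (suc k *_) (sym expansion))
    where
    expansion : tilings (k + (suc w + suc w)) 0 (suc w) + 2 * 0 + 3 * endTromino (k + (suc w + suc w)) 0 (suc w)
              ≡ (suc w C suc w) * (k C suc w) + 2 * (0 * (k C w)) + 3 * ((w C w) * (k C w))
    expansion = cong₂ (λ x y → x + 2 * 0 + 3 * y) (tilings-closed k 0 (suc w)) (endTromino-closed k 0 w)
  cyclic-closed k (suc v) (suc w) =
    trans (cyclic-weights (suc k) I (suc w) c (k C suc I) (suc k C suc I) (k C I) (I C suc w) (I C w)
            (absorption-complement k (suc I)) (absorption k I) (absorption-complement I (suc w)) (absorption I w))
          (cong (suc k *_) (sym expansion))
    where
    I = v + suc w
    X = suc v + suc w + suc w
    c = suc I C suc w
    expansion : tilings (k + X) (suc v) (suc w) + 2 * endDomino (k + X) (suc v) (suc w) + 3 * endTromino (k + X) (suc v) (suc w)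
              ≡ c * (k C suc I) + 2 * ((I C suc w) * (k C I)) + 3 * ((I C w) * (k C I))
    expansion = cong₂ _+_ (cong₂ (λ x y → x + 2 * y) (tilings-closed k (suc v) (suc w)) (endDomino-closed k v (suc w)))
                          (cong (3 *_) (trans (endTromino-closed k (suc v) w) (cong (λ j → (j C w) * (k C j)) (sym (+-suc v w)))))

module Layers where

  open Tilings
  open CyclicTilings
  open import Data.Nat using (ℕ; zero; suc; _+_; _*_; _∸_; _≤_; z≤n)
  open import Data.Nat.Properties using (+-identityʳ; +-suc; +-assoc; *-identityˡ; m≤n⇒m≤1+n; ≤-refl; +-∸-assoc; n∸n≡0)
  open import Data.Nat.Combinatorics using (_C_; nCn≡1)
  open import Data.Nat.Tactic.RingSolver using (solve-∀)
  open import Relation.Binary.PropositionalEquality using (_≡_; refl; sym; trans; cong; cong₂; module ≡-Reasoning)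
  open ≡-Reasoning

  antidiagonal : ℕ → (ℕ → ℕ → ℕ) → ℕ
  antidiagonal zero    f = f 0 0
  antidiagonal (suc i) f = antidiagonal i (λ v w → f (suc v) w) + f 0 (suc i)

  antidiagonal-cong : ∀ i f g → (∀ v w → f v w ≡ g v w) → antidiagonal i f ≡ antidiagonal i g
  antidiagonal-cong zero    f g f≗g = f≗g 0 0
  antidiagonal-cong (suc i) f g f≗g =
    cong₂ _+_ (antidiagonal-cong i _ _ (λ v w → f≗g (suc v) w)) (f≗g 0 (suc i))

  antidiagonal-+ : ∀ i f g → antidiagonal i (λ v w → f v w + g v w) ≡ antidiagonal i f + antidiagonal i g
  antidiagonal-+ zero    f g = refl
  antidiagonal-+ (suc i) f g =
    trans (cong (_+ (f 0 (suc i) + g 0 (suc i))) (antidiagonal-+ i (λ v w → f (suc v) w) (λ v w → g (suc v) w)))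
          (interchange (antidiagonal i (λ v w → f (suc v) w)) (antidiagonal i (λ v w → g (suc v) w)) (f 0 (suc i)) (g 0 (suc i)))
    where
    interchange : ∀ a b c d → (a + b) + (c + d) ≡ (a + c) + (b + d)
    interchange = solve-∀

  antidiagonal-withDomino : ∀ i f → antidiagonal (suc i) (withDomino f) ≡ antidiagonal i f
  antidiagonal-withDomino i f = +-identityʳ _

  antidiagonal-withTromino : ∀ i f → antidiagonal (suc i) (withTromino f) ≡ antidiagonal i f
  antidiagonal-withTromino zero    f = refl
  antidiagonal-withTromino (suc i) f = cong (_+ f 0 (suc i))
    (trans (antidiagonal-cong (suc i) _ _ withTromino-suc) (antidiagonal-withTromino i (λ v w → f (suc v) w)))
    where
    withTromino-suc : ∀ v w → withTromino f (suc v) w ≡ withTromino (λ v w → f (suc v) w) v w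
    withTromino-suc v zero    = refl
    withTromino-suc v (suc w) = refl

  antidiagonal-corner : ∀ i f → (∀ v w → v + suc w ≡ i → f v (suc w) ≡ 0) → antidiagonal i f ≡ f i 0
  antidiagonal-corner zero    f vanish = refl
  antidiagonal-corner (suc i) f vanish =
    trans (cong₂ _+_ (antidiagonal-corner i _ (λ v w e → vanish (suc v) w (cong suc e))) (vanish 0 i refl))
          (+-identityʳ _)

  sumUpTo : ℕ → (ℕ → ℕ) → ℕ
  sumUpTo zero    f = f 0
  sumUpTo (suc s) f = sumUpTo s f + f (suc s)

  sumUpTo-cong : ∀ s f g → (∀ i → i ≤ s → f i ≡ g i) → sumUpTo s f ≡ sumUpTo s g
  sumUpTo-cong zero    f g f≗g = f≗g 0 z≤n
  sumUpTo-cong (suc s) f g f≗g =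
    cong₂ _+_ (sumUpTo-cong s f g (λ i i≤s → f≗g i (m≤n⇒m≤1+n i≤s))) (f≗g (suc s) ≤-refl)

  sumUpTo-+ : ∀ s f g → sumUpTo s (λ i → f i + g i) ≡ sumUpTo s f + sumUpTo s g
  sumUpTo-+ zero    f g = refl
  sumUpTo-+ (suc s) f g =
    trans (cong (_+ (f (suc s) + g (suc s))) (sumUpTo-+ s f g))
          (interchange (sumUpTo s f) (sumUpTo s g) (f (suc s)) (g (suc s)))
    where
    interchange : ∀ a b c d → (a + b) + (c + d) ≡ (a + c) + (b + d)
    interchange = solve-∀

  sumUpTo-shift : ∀ s f → sumUpTo (suc s) f ≡ f 0 + sumUpTo s (λ i → f (suc i))
  sumUpTo-shift zero    f = refl
  sumUpTo-shift (suc s) f = trans (cong (_+ f (suc (suc s))) (sumUpTo-shift s f)) (+-assoc (f 0) _ _)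

  antidiagonal-by-trominoes : ∀ i f → sumUpTo i (λ j → f (i ∸ j) j) ≡ antidiagonal i f
  antidiagonal-by-trominoes zero    f = refl
  antidiagonal-by-trominoes (suc i) f = cong₂ _+_
    (trans (sumUpTo-cong i _ _ (λ j j≤i → cong (λ v → f v j) (+-∸-assoc 1 j≤i)))
           (antidiagonal-by-trominoes i (λ v w → f (suc v) w)))
    (cong (λ v → f v (suc i)) (n∸n≡0 i))

  cyclicB : ℕ → ℕ → ℕ
  cyclicB N i = antidiagonal i (cyclic N)

  cyclicK : ℕ → ℕ → ℕ
  cyclicK N s = sumUpTo s (cyclicB N)

  cyclicB-zero : ∀ N → cyclicB (suc N) 0 ≡ 1
  cyclicB-zero N = trans (+-identityʳ _) (trans (+-identityʳ _) (tilings-squares N))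

  cyclicB-rec : ∀ n i → cyclicB (suc (suc (suc (suc n)))) (suc i)
              ≡ cyclicB (suc (suc (suc n))) (suc i) + cyclicB (suc (suc n)) i + cyclicB (suc n) i
  cyclicB-rec n i = begin
    antidiagonal (suc i) (cyclic N₄)
      ≡⟨ antidiagonal-cong (suc i) _ _ (cyclic-rec n) ⟩
    antidiagonal (suc i) (λ v w → cyclic N₃ v w + withDomino (cyclic N₂) v w + withTromino (cyclic N₁) v w)
      ≡⟨ antidiagonal-+ (suc i) (λ v w → cyclic N₃ v w + withDomino (cyclic N₂) v w) (withTromino (cyclic N₁)) ⟩
    antidiagonal (suc i) (λ v w → cyclic N₃ v w + withDomino (cyclic N₂) v w) + antidiagonal (suc i) (withTromino (cyclic N₁))
      ≡⟨ cong₂ _+_ (antidiagonal-+ (suc i) (cyclic N₃) (withDomino (cyclic N₂))) (antidiagonal-withTromino i (cyclic N₁)) ⟩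
    antidiagonal (suc i) (cyclic N₃) + antidiagonal (suc i) (withDomino (cyclic N₂)) + antidiagonal i (cyclic N₁)
      ≡⟨ cong (λ z → antidiagonal (suc i) (cyclic N₃) + z + antidiagonal i (cyclic N₁)) (antidiagonal-withDomino i (cyclic N₂)) ⟩
    antidiagonal (suc i) (cyclic N₃) + antidiagonal i (cyclic N₂) + antidiagonal i (cyclic N₁) ∎
    where
    N₁ = suc n
    N₂ = suc N₁
    N₃ = suc N₂
    N₄ = suc N₃

  -- The top layer of an even length 2(i+1): only the tiling by i+1 dominoes
  -- survives, and it is counted twice (B(m,m) = 2).
  cyclicB-diagonal : ∀ i → cyclicB (suc i + suc i) (suc i) ≡ 2
  cyclicB-diagonal i = begin
    antidiagonal (suc i) (cyclic N)
      ≡⟨ antidiagonal-corner (suc i) (cyclic N) (λ v w e → cyclic-vanish N v (suc w) w (too-long v w e)) ⟩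
    cyclic N (suc i) 0
      ≡⟨ cong₂ (λ x y → x + 2 * y + 3 * 0) (tilings-vanish (i + suc i) (suc i) 0 0 (lengths i))
                                           (trans (endDomino-at (+-suc i i)) (dominoes-only i)) ⟩
    2 ∎
    where
    N = suc i + suc i
    lengths : ∀ i → (i + suc i) + 1 ≡ suc i + suc i + 0 + 0 + 0
    lengths = solve-∀
    lengths′ : ∀ v w → (v + suc w + (v + suc w)) + suc w ≡ v + v + suc w + suc w + suc w
    lengths′ = solve-∀
    too-long : ∀ v w → v + suc w ≡ suc i → N + suc w ≡ v + v + suc w + suc w + suc w
    too-long v w e = trans (cong (λ z → z + z + suc w) (sym e)) (lengths′ v w)
    dominoes-only : ∀ i → tilings (i + i) i 0 ≡ 1
    dominoes-only i = begin
      tilings (i + i) i 0             ≡⟨ cong (λ z → tilings (i + z) i 0) (sym (trans (+-identityʳ (i + 0)) (+-identityʳ i))) ⟩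
      tilings (i + (i + 0 + 0)) i 0   ≡⟨ tilings-closed i i 0 ⟩
      1 * (i C (i + 0))               ≡⟨ trans (*-identityˡ _) (cong (i C_) (+-identityʳ i)) ⟩
      i C i                           ≡⟨ nCn≡1 i ⟩
      1 ∎

  cyclicK-rec-suc : ∀ n s → cyclicK (suc (suc (suc (suc n)))) (suc s)
                  ≡ cyclicK (suc (suc (suc n))) (suc s) + cyclicK (suc (suc n)) s + cyclicK (suc n) s
  cyclicK-rec-suc n s = begin
    sumUpTo (suc s) (cyclicB N₄)
      ≡⟨ sumUpTo-shift s (cyclicB N₄) ⟩
    cyclicB N₄ 0 + sumUpTo s (λ i → cyclicB N₄ (suc i))
      ≡⟨ cong₂ _+_ (cyclicB-zero N₃) (sumUpTo-cong s _ _ (λ i _ → cyclicB-rec n i)) ⟩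
    1 + sumUpTo s (λ i → cyclicB N₃ (suc i) + cyclicB N₂ i + cyclicB N₁ i)
      ≡⟨ cong (1 +_) (trans (sumUpTo-+ s (λ i → cyclicB N₃ (suc i) + cyclicB N₂ i) (cyclicB N₁))
                            (cong (_+ cyclicK N₁ s) (sumUpTo-+ s (λ i → cyclicB N₃ (suc i)) (cyclicB N₂)))) ⟩
    1 + (S₃ + cyclicK N₂ s + cyclicK N₁ s)
      ≡⟨ reassociate S₃ (cyclicK N₂ s) (cyclicK N₁ s) ⟩
    (1 + S₃) + cyclicK N₂ s + cyclicK N₁ s
      ≡⟨ cong (λ z → z + cyclicK N₂ s + cyclicK N₁ s)
              (sym (trans (sumUpTo-shift s (cyclicB N₃)) (cong (_+ S₃) (cyclicB-zero N₂)))) ⟩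
    cyclicK N₃ (suc s) + cyclicK N₂ s + cyclicK N₁ s ∎
    where
    N₁ = suc n
    N₂ = suc N₁
    N₃ = suc N₂
    N₄ = suc N₃
    S₃ = sumUpTo s (λ i → cyclicB N₃ (suc i))
    reassociate : ∀ a b c → 1 + (a + b + c) ≡ (1 + a) + b + c
    reassociate = solve-∀

  -- Part (ii) for the natural-number sums, with the subtracted layers moved left.
  cyclicK-rec : ∀ n s → cyclicK (suc (suc (suc (suc n)))) s + cyclicB (suc (suc n)) s + cyclicB (suc n) s
              ≡ cyclicK (suc (suc (suc n))) s + cyclicK (suc (suc n)) s + cyclicK (suc n) s
  cyclicK-rec n zero =
    cong (λ z → z + cyclicB (suc (suc n)) 0 + cyclicB (suc n) 0) (trans (cyclicB-zero (suc (suc (suc n)))) (sym (cyclicB-zero (suc (suc n)))))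
  cyclicK-rec n (suc s) =
    trans (cong (λ z → z + cyclicB (suc (suc n)) (suc s) + cyclicB (suc n) (suc s)) (cyclicK-rec-suc n s))
          (regroup (cyclicK (suc (suc (suc n))) (suc s)) (cyclicK (suc (suc n)) s) (cyclicK (suc n) s)
                   (cyclicB (suc (suc n)) (suc s)) (cyclicB (suc n) (suc s)))
    where
    regroup : ∀ x a b c d → x + a + b + c + d ≡ x + (a + c) + (b + d)
    regroup = solve-∀


module NaturalsInRationals where

  open import Data.Nat using (ℕ; suc)
  import Data.Nat as ℕ
  open import Data.Nat.Properties using (*-comm)
  open import Data.Integer using (+_)
  import Data.Integer as ℤ
  import Data.Integer.Properties as ℤ
  open import Data.Rational using (ℚ; _/_; _+_)
  open import Data.Rational.Properties using (toℚᵘ-injective; toℚᵘ-homo-+; toℚᵘ-fromℚᵘ; fromℚᵘ-cong)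
  import Data.Rational.Unnormalised as ℚᵘ
  import Data.Rational.Unnormalised.Properties as ℚᵘ
  open import Relation.Binary.PropositionalEquality using (_≡_; sym; cong; cong₂; trans; module ≡-Reasoning)
  open ≡-Reasoning
  open import Defs using (frac)

  ι : ℕ → ℚ
  ι a = (+ a) / 1

  -- Its unnormalised counterpart, in which addition is computed literally.
  ιᵘ : ℕ → ℚᵘ.ℚᵘ
  ιᵘ a = ℚᵘ.mkℚᵘ (+ a) 0

  ιᵘ-+ : ∀ a b → ιᵘ a ℚᵘ.+ ιᵘ b ℚᵘ.≃ ιᵘ (a ℕ.+ b)
  ιᵘ-+ a b = ℚᵘ.*≡* (begin
    (+ a ℤ.* + 1 ℤ.+ + b ℤ.* + 1) ℤ.* + 1   ≡⟨ ℤ.*-identityʳ _ ⟩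
    + a ℤ.* + 1 ℤ.+ + b ℤ.* + 1             ≡⟨ cong₂ ℤ._+_ (ℤ.*-identityʳ (+ a)) (ℤ.*-identityʳ (+ b)) ⟩
    + a ℤ.+ + b                             ≡⟨ sym (ℤ.pos-+ a b) ⟩
    + (a ℕ.+ b)                             ≡⟨ sym (ℤ.*-identityʳ _) ⟩
    + (a ℕ.+ b) ℤ.* + 1                     ∎)

  -- ι is additive; ℚ addition is transported from ℚᵘ, where this is ιᵘ-+.
  ι-+ : ∀ a b → ι (a ℕ.+ b) ≡ ι a + ι b
  ι-+ a b = toℚᵘ-injective (ℚᵘ.≃-sym (ℚᵘ.≃-trans (toℚᵘ-homo-+ (ι a) (ι b))
    (ℚᵘ.≃-trans (ℚᵘ.+-cong (toℚᵘ-fromℚᵘ (ιᵘ a)) (toℚᵘ-fromℚᵘ (ιᵘ b)))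
    (ℚᵘ.≃-trans (ιᵘ-+ a b) (ℚᵘ.≃-sym (toℚᵘ-fromℚᵘ (ιᵘ (a ℕ.+ b))))))))

  ι-+₃ : ∀ a b c → ι (a ℕ.+ b ℕ.+ c) ≡ ι a + ι b + ι c
  ι-+₃ a b c = trans (ι-+ (a ℕ.+ b) c) (cong (_+ ι c) (ι-+ a b))

  frac-cancel : ∀ k e → frac (suc k ℕ.* e) (suc k) ≡ ι e
  frac-cancel k e = fromℚᵘ-cong {ℚᵘ.mkℚᵘ (+ (suc k ℕ.* e)) k} {ιᵘ e} (ℚᵘ.*≡* (begin
    + (suc k ℕ.* e) ℤ.* + 1   ≡⟨ ℤ.*-identityʳ _ ⟩
    + (suc k ℕ.* e)           ≡⟨ cong +_ (*-comm (suc k) e) ⟩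
    + (e ℕ.* suc k)           ≡⟨ ℤ.pos-* e (suc k) ⟩
    + e ℤ.* + suc k           ∎))

module Transfer where

  open NaturalsInRationals
  open CyclicTilings
  open Layers
  open import Defs
  open import Data.Nat using (ℕ; zero; suc; _∸_; _≤_; _<_; z≤n; _<?_)
  import Data.Nat as ℕ
  open import Data.Nat.Properties
  open import Data.Nat.Combinatorics using (_C_)
  open import Data.Nat.Tactic.RingSolver using (solve-∀)
  open import Data.Rational using (_+_)
  open import Data.Empty using (⊥-elim)
  open import Relation.Nullary using (Dec; yes; no; ¬_)
  open import Relation.Binary.PropositionalEquality using (_≡_; refl; sym; trans; cong; cong₂; module ≡-Reasoning)
  open ≡-Reasoning

  sumTo-cong : ∀ s f g → (∀ i → i ≤ s → f i ≡ g i) → sumTo s f ≡ sumTo s g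
  sumTo-cong zero    f g f≗g = f≗g 0 z≤n
  sumTo-cong (suc s) f g f≗g =
    cong₂ _+_ (sumTo-cong s f g (λ i i≤s → f≗g i (m≤n⇒m≤1+n i≤s))) (f≗g (suc s) ≤-refl)

  sumTo-ι : ∀ s f → sumTo s (λ i → ι (f i)) ≡ ι (sumUpTo s f)
  sumTo-ι zero    f = refl
  sumTo-ι (suc s) f = trans (cong (_+ ι (f (suc s))) (sumTo-ι s f)) (sym (ι-+ (sumUpTo s f) (f (suc s))))

  B-below : ∀ m i → i < m → B m i ≡ sumTo i (λ j → frac ((m ℕ.+ i) ℕ.* (i C j) ℕ.* ((m ∸ j) C i)) (m ∸ j))
  B-below m i i<m with i <? m
  ... | yes _   = refl
  ... | no  i≮m = ⊥-elim (i≮m i<m)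

  B-top : ∀ m i → ¬ (i < m) → B m i ≡ ι 2
  B-top m i i≮m with i <? m
  ... | yes i<m = ⊥-elim (i≮m i<m)
  ... | no  _   = refl

  -- With m - j = k+1 and i = v + j, the j-th summand of B(m, i) is the closed
  -- form of cyclic tilings of length m + i with v dominoes and j trominoes.
  B-summand-closed : ∀ k v j →
    frac ((suc k ℕ.+ j ℕ.+ (v ℕ.+ j)) ℕ.* ((v ℕ.+ j) C j) ℕ.* (suc k C (v ℕ.+ j))) (suc k)
      ≡ ι (cyclic (suc k ℕ.+ j ℕ.+ (v ℕ.+ j)) v j)
  B-summand-closed k v j = trans (cong (λ e → frac e (suc k)) numerator) (frac-cancel k (cyclic N v j))
    where
    N = suc k ℕ.+ j ℕ.+ (v ℕ.+ j)
    lengths : ∀ K v j → K ℕ.+ j ℕ.+ (v ℕ.+ j) ≡ K ℕ.+ (v ℕ.+ j ℕ.+ j)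
    lengths = solve-∀
    length : N ≡ suc k ℕ.+ (v ℕ.+ j ℕ.+ j)
    length = lengths (suc k) v j
    numerator : N ℕ.* ((v ℕ.+ j) C j) ℕ.* (suc k C (v ℕ.+ j)) ≡ suc k ℕ.* cyclic N v j
    numerator = begin
      N ℕ.* ((v ℕ.+ j) C j) ℕ.* (suc k C (v ℕ.+ j))
        ≡⟨ *-assoc N ((v ℕ.+ j) C j) (suc k C (v ℕ.+ j)) ⟩
      N ℕ.* (((v ℕ.+ j) C j) ℕ.* (suc k C (v ℕ.+ j)))
        ≡⟨ cong (λ L → L ℕ.* (((v ℕ.+ j) C j) ℕ.* (suc k C (v ℕ.+ j)))) length ⟩
      (suc k ℕ.+ (v ℕ.+ j ℕ.+ j)) ℕ.* (((v ℕ.+ j) C j) ℕ.* (suc k C (v ℕ.+ j)))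
        ≡⟨ cyclic-closed k v j ⟩
      suc k ℕ.* cyclic (suc k ℕ.+ (v ℕ.+ j ℕ.+ j)) v j
        ≡⟨ cong (λ L → suc k ℕ.* cyclic L v j) (sym length) ⟩
      suc k ℕ.* cyclic N v j ∎

  B-summand : ∀ m i j → j ≤ i → i < m →
    frac ((m ℕ.+ i) ℕ.* (i C j) ℕ.* ((m ∸ j) C i)) (m ∸ j) ≡ ι (cyclic (m ℕ.+ i) (i ∸ j) j)
  B-summand m i j j≤i i<m =
    decomposed (m ∸ j) (i ∸ j) (sym (m∸n+n≡m (≤-trans j≤i (<⇒≤ i<m)))) (sym (m∸n+n≡m j≤i)) i<m
    where
    decomposed : ∀ q v {m′ i′} → m′ ≡ q ℕ.+ j → i′ ≡ v ℕ.+ j → i′ < m′ →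
      frac ((m′ ℕ.+ i′) ℕ.* (i′ C j) ℕ.* ((m′ ∸ j) C i′)) (m′ ∸ j) ≡ ι (cyclic (m′ ℕ.+ i′) (i′ ∸ j) j)
    decomposed zero    v refl refl i<m = ⊥-elim (<⇒≱ i<m (m≤n+m j v))
    decomposed (suc k) v refl refl _
      rewrite m+n∸n≡m (suc k) j =
        trans (B-summand-closed k v j) (cong (λ v′ → ι (cyclic (suc k ℕ.+ j ℕ.+ (v ℕ.+ j)) v′ j)) (sym (m+n∸n≡m v j)))

  cyclicB-top : ∀ N i → 1 ≤ N → N ≡ i ℕ.+ i → cyclicB N i ≡ 2
  cyclicB-top _ zero    () refl
  cyclicB-top _ (suc i) _  refl = cyclicB-diagonal i

  B≡cyclicB : ∀ N i → 1 ≤ N → i ℕ.+ i ≤ N → B (N ∸ i) i ≡ ι (cyclicB N i)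
  B≡cyclicB N i 1≤N 2i≤N = by-cases (i <? N ∸ i)
    where
    N∸i+i≡N : N ∸ i ℕ.+ i ≡ N
    N∸i+i≡N = m∸n+n≡m (m+n≤o⇒n≤o i 2i≤N)
    by-cases : Dec (i < N ∸ i) → B (N ∸ i) i ≡ ι (cyclicB N i)
    by-cases (yes i<m) = begin
      B (N ∸ i) i
        ≡⟨ B-below (N ∸ i) i i<m ⟩
      sumTo i (λ j → frac ((N ∸ i ℕ.+ i) ℕ.* (i C j) ℕ.* ((N ∸ i ∸ j) C i)) (N ∸ i ∸ j))
        ≡⟨ sumTo-cong i _ _ (λ j j≤i → trans (B-summand (N ∸ i) i j j≤i i<m) (cong (λ L → ι (cyclic L (i ∸ j) j)) N∸i+i≡N)) ⟩
      sumTo i (λ j → ι (cyclic N (i ∸ j) j))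
        ≡⟨ sumTo-ι i (λ j → cyclic N (i ∸ j) j) ⟩
      ι (sumUpTo i (λ j → cyclic N (i ∸ j) j))
        ≡⟨ cong ι (antidiagonal-by-trominoes i (cyclic N)) ⟩
      ι (cyclicB N i) ∎
    by-cases (no i≮m) = trans (B-top (N ∸ i) i i≮m) (cong ι (sym (cyclicB-top N i 1≤N N≡i+i)))
      where
      N∸i≡i : N ∸ i ≡ i
      N∸i≡i = ≤-antisym (≮⇒≥ i≮m) (m+n≤o⇒m≤o∸n i 2i≤N)
      N≡i+i : N ≡ i ℕ.+ i
      N≡i+i = trans (sym N∸i+i≡N) (cong (ℕ._+ i) N∸i≡i)

  K≡cyclicK : ∀ N s → 1 ≤ N → s ℕ.+ s ≤ N → K N s ≡ ι (cyclicK N s)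
  K≡cyclicK N s 1≤N 2s≤N =
    trans (sumTo-cong s _ _ (λ i i≤s → B≡cyclicB N i 1≤N (≤-trans (+-mono-≤ i≤s i≤s) 2s≤N))) (sumTo-ι s (cyclicB N))

open import Defs
open import Data.Nat using (ℕ; _≤_; _∸_; suc; z≤n; s≤s)
import Data.Nat as ℕ
open import Data.Nat.Properties using (+-comm; ≤-trans; ≤-reflexive; *-monoˡ-≤; n≤1+n)
open import Data.Nat.DivMod using (_/_; m/n*n≤m)
open import Data.Nat.Tactic.RingSolver using (solve-∀)
open import Data.Rational using (ℚ; _+_; _-_)
open import Data.Rational.Solver using (module +-*-Solver)
open import Data.Product using (_×_; _,_)
open import Relation.Binary.PropositionalEquality using (_≡_; refl; sym; trans; cong; cong₂; module ≡-Reasoning)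
open ≡-Reasoning
open NaturalsInRationals
open Layers
open Transfer

isolate : ∀ {a b c d : ℚ} → a + b + c ≡ d → a ≡ d - b - c
isolate {a} {b} {c} eq = trans (sym (cancel a b c)) (cong (λ x → x - b - c) eq)
  where
  open +-*-Solver
  cancel : ∀ a b c → a + b + c - b - c ≡ a
  cancel = solve 3 (λ a b c → a :+ b :+ c :- b :- c := a) refl

double-≤ : ∀ {n s} → s ≤ n / 2 → s ℕ.+ s ≤ n
double-≤ {n} {s} s≤n/2 = ≤-trans (≤-reflexive (twice s)) (≤-trans (*-monoˡ-≤ 2 s≤n/2) (m/n*n≤m n 2))
  where
  twice : ∀ s → s ℕ.+ s ≡ s ℕ.* 2
  twice = solve-∀

K-rec-suc : ∀ n s → s ℕ.+ s ≤ suc n →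
  K (suc (suc (suc (suc n)))) (suc s) ≡ K (suc (suc (suc n))) (suc s) + K (suc (suc n)) s + K (suc n) s
K-rec-suc n s 2s≤N₁ = begin
  K N₄ (suc s)                                             ≡⟨ K≡cyclicK N₄ (suc s) (s≤s z≤n) 2s+2≤N₄ ⟩
  ι (cyclicK N₄ (suc s))                                   ≡⟨ cong ι (cyclicK-rec-suc n s) ⟩
  ι (cyclicK N₃ (suc s) ℕ.+ cyclicK N₂ s ℕ.+ cyclicK N₁ s) ≡⟨ ι-+₃ (cyclicK N₃ (suc s)) (cyclicK N₂ s) (cyclicK N₁ s) ⟩
  ι (cyclicK N₃ (suc s)) + ι (cyclicK N₂ s) + ι (cyclicK N₁ s)
    ≡⟨ sym (cong₂ _+_ (cong₂ _+_ (K≡cyclicK N₃ (suc s) (s≤s z≤n) 2s+2≤N₃) (K≡cyclicK N₂ s (s≤s z≤n) 2s≤N₂))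
                      (K≡cyclicK N₁ s (s≤s z≤n) 2s≤N₁)) ⟩
  K N₃ (suc s) + K N₂ s + K N₁ s                           ∎
  where
  N₁ = suc n
  N₂ = suc N₁
  N₃ = suc N₂
  N₄ = suc N₃
  2s≤N₂ : s ℕ.+ s ≤ N₂
  2s≤N₂ = ≤-trans 2s≤N₁ (n≤1+n N₁)
  2s+2≤N₃ : suc s ℕ.+ suc s ≤ N₃
  2s+2≤N₃ = ≤-trans (≤-reflexive (cong suc (+-comm s (suc s)))) (s≤s (s≤s 2s≤N₁))
  2s+2≤N₄ : suc s ℕ.+ suc s ≤ N₄
  2s+2≤N₄ = ≤-trans 2s+2≤N₃ (n≤1+n N₃)

K-rec : ∀ n s → s ℕ.+ s ≤ suc n →
  K (suc (suc (suc (suc n)))) s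
    ≡ K (suc (suc (suc n))) s + K (suc (suc n)) s + K (suc n) s - B (suc (suc n) ∸ s) s - B (suc n ∸ s) s
K-rec n s 2s≤N₁ = begin
  K N₄ s
    ≡⟨ K≡cyclicK N₄ s (s≤s z≤n) (≤-trans 2s≤N₃ (n≤1+n N₃)) ⟩
  ι (cyclicK N₄ s)
    ≡⟨ isolate (begin
         ι (cyclicK N₄ s) + ι (cyclicB N₂ s) + ι (cyclicB N₁ s)  ≡⟨ sym (ι-+₃ (cyclicK N₄ s) (cyclicB N₂ s) (cyclicB N₁ s)) ⟩
         ι (cyclicK N₄ s ℕ.+ cyclicB N₂ s ℕ.+ cyclicB N₁ s)      ≡⟨ cong ι (cyclicK-rec n s) ⟩
         ι (cyclicK N₃ s ℕ.+ cyclicK N₂ s ℕ.+ cyclicK N₁ s)      ≡⟨ ι-+₃ (cyclicK N₃ s) (cyclicK N₂ s) (cyclicK N₁ s) ⟩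
         ι (cyclicK N₃ s) + ι (cyclicK N₂ s) + ι (cyclicK N₁ s)  ∎) ⟩
  ι (cyclicK N₃ s) + ι (cyclicK N₂ s) + ι (cyclicK N₁ s) - ι (cyclicB N₂ s) - ι (cyclicB N₁ s)
    ≡⟨ sym (cong₂ _-_ (cong₂ _-_ (cong₂ _+_ (cong₂ _+_ (K≡cyclicK N₃ s (s≤s z≤n) 2s≤N₃) (K≡cyclicK N₂ s (s≤s z≤n) 2s≤N₂))
                                            (K≡cyclicK N₁ s (s≤s z≤n) 2s≤N₁))
                                 (B≡cyclicB N₂ s (s≤s z≤n) 2s≤N₂))
                      (B≡cyclicB N₁ s (s≤s z≤n) 2s≤N₁)) ⟩
  K N₃ s + K N₂ s + K N₁ s - B (N₂ ∸ s) s - B (N₁ ∸ s) s ∎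
  where
  N₁ = suc n
  N₂ = suc N₁
  N₃ = suc N₂
  N₄ = suc N₃
  2s≤N₂ : s ℕ.+ s ≤ N₂
  2s≤N₂ = ≤-trans 2s≤N₁ (n≤1+n N₁)
  2s≤N₃ : s ℕ.+ s ≤ N₃
  2s≤N₃ = ≤-trans 2s≤N₂ (n≤1+n N₂)

corollary3 : (n s : ℕ) → 1 ≤ n → s ≤ n / 2 →
    (K (n ℕ.+ 3) (ℕ.suc s) ≡ K (n ℕ.+ 2) (ℕ.suc s) + K (n ℕ.+ 1) s + K n s)
    × (K (n ℕ.+ 3) s ≡ K (n ℕ.+ 2) s + K (n ℕ.+ 1) s + K n s - B (n ℕ.+ 1 ∸ s) s - B (n ∸ s) s)
corollary3 (suc n) s (s≤s z≤n) s≤n/2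
  rewrite +-comm n 3 | +-comm n 2 | +-comm n 1 = K-rec-suc n s 2s≤n , K-rec n s 2s≤n
  where
  2s≤n : s ℕ.+ s ≤ suc n
  2s≤n = double-≤ s≤n/2
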